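{- Let $G$ be a directed 3-regular graph. Then there exists a polynomial $P$ in six variables with integer coefficients such that for all $w,x,y,z\in\mathbb{C}$, \[\sum_{\sigma:V(G)\to\{0,1\}}\ \prod_{(u,v)\in E(G)} f(\sigma(u),\sigma(v)) = P\big(wz,\ xy,\ w^3+z^3,\ x+y,\ w^3x+yz^3,\ w^3y+xz^3\big),\] where $f(0,0)=w$, $f(0,1)=x$, $f(1,0)=y$, $f(1,1)=z$.
   Context: A directed 3-regular graph is a directed graph in which every vertex has total degree 3. The left-hand side is the Holant value of the signature grid with underlying graph $G$, vertex signature $=_3$ and edge signature $(w,x,y,z)$. -}

module Defs where

open import Level using (0ℓ)
open import Data.Nat using (ℕ; zero; suc) renaming (_+_ to _+ℕ_)
open import Data.Integer using (ℤ; +_; -[1+_])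
open import Data.Bool using (Bool; true; false; if_then_else_)
open import Data.Fin using (Fin; zero; suc; _≟_)
open import Data.Product using (_×_; _,_; proj₁; proj₂)
open import Relation.Nullary.Decidable using (⌊_⌋)
open import Algebra.Bundles using (CommutativeRing)
open import Relation.Binary.PropositionalEquality using (_≡_)

record DiGraph : Set where
  field
    n    : ℕ
    m    : ℕ
    edge : Fin m → Fin n × Fin n

countFin : {k : ℕ} → (Fin k → Bool) → ℕ
countFin {zero}  p = 0
countFin {suc k} p = (if p zero then 1 else 0) +ℕ countFin (λ i → p (suc i))

-- total degree = out-degree + in-degree (a loop counts twice)
degree : (G : DiGraph) → Fin (DiGraph.n G) → ℕ
degree G v = countFin (λ e → ⌊ proj₁ (edge e) ≟ v ⌋)
           +ℕ countFin (λ e → ⌊ proj₂ (edge e) ≟ v ⌋)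
  where open DiGraph G

Is3Regular : DiGraph → Set
Is3Regular G = (v : Fin (DiGraph.n G)) → degree G v ≡ 3

data Poly (k : ℕ) : Set where
  con  : ℤ → Poly k
  var  : Fin k → Poly k
  _⊕_  : Poly k → Poly k → Poly k
  _⊗_  : Poly k → Poly k → Poly k

module _ (R : CommutativeRing 0ℓ 0ℓ) where
  open CommutativeRing R using (Carrier; _+_; _*_; -_; 0#; 1#)

  natR : ℕ → Carrier
  natR zero    = 0#
  natR (suc n) = 1# + natR n

  intR : ℤ → Carrier
  intR (+ n)      = natR n
  intR -[1+ n ]   = - natR (suc n)

  eval : {k : ℕ} → Poly k → (Fin k → Carrier) → Carrier
  eval (con c) ρ = intR c
  eval (var i) ρ = ρ i
  eval (p ⊕ q) ρ = eval p ρ + eval q ρ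
  eval (p ⊗ q) ρ = eval p ρ * eval q ρ

  -- sum over all assignments σ : Fin k → Bool (false = 0, true = 1)
  sumAssign : (k : ℕ) → ((Fin k → Bool) → Carrier) → Carrier
  sumAssign zero    F = F (λ ())
  sumAssign (suc k) F = sumAssign k (λ σ → F (cons false σ))
                      + sumAssign k (λ σ → F (cons true σ))
    where
      cons : Bool → (Fin k → Bool) → Fin (suc k) → Bool
      cons b σ zero    = b
      cons b σ (suc i) = σ i

  prodFin : {k : ℕ} → (Fin k → Carrier) → Carrier
  prodFin {zero}  g = 1#
  prodFin {suc k} g = g zero * prodFin (λ i → g (suc i))

  sig : Carrier → Carrier → Carrier → Carrier → Bool → Bool → Carrier
  sig w x y z false false = w
  sig w x y z false true  = x
  sig w x y z true  false = y
  sig w x y z true  true  = z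

  -- Holant value with vertex signature =_3 and edge signature (w,x,y,z)
  holant : DiGraph → Carrier → Carrier → Carrier → Carrier → Carrier
  holant G w x y z =
    sumAssign n (λ σ → prodFin (λ e → sig w x y z (σ (proj₁ (edge e))) (σ (proj₂ (edge e)))))
    where open DiGraph G

  cube : Carrier → Carrier
  cube a = a * a * a

  args6 : Carrier → Carrier → Carrier → Carrier → Fin 6 → Carrier
  args6 w x y z zero = w * z
  args6 w x y z (suc zero) = x * y
  args6 w x y z (suc (suc zero)) = cube w + cube z
  args6 w x y z (suc (suc (suc zero))) = x + y
  args6 w x y z (suc (suc (suc (suc zero)))) = cube w * x + y * cube z
  args6 w x y z (suc (suc (suc (suc (suc zero))))) = cube w * y + x * cube z

-- Pairing each assignment σ with its complement σ̄ swaps the numbers a, b, c, d of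
-- edges labelled 00, 01, 10, 11, so the pair contributes w^a x^b y^c z^d + w^d x^c y^b z^a.
-- Counting endpoints with 3-regularity gives 3·|σ⁻¹(1)| + 2a = 3·|σ⁻¹(0)| + 2d, hence
-- a ≡ d (mod 3). For a = d + 3t and b = c + j the pair is (wz)^d (xy)^c (Wᵗ xʲ + Zᵗ yʲ)
-- with W = w³, Z = z³, and every sequence α Xⁿ + β Yⁿ obeys
-- uₙ₊₂ = (X + Y) uₙ₊₁ − XY uₙ, so Wᵗ xʲ + Zᵗ yʲ is an integer polynomial in
-- W + Z, WZ = (wz)³, x + y, xy and its first terms W x + Z y and W y + Z x.
-- Fixing the colour of one vertex enumerates every complementary pair exactly once.

module Submission where

open import Defs
open import Level using (0ℓ)
open import Algebra.Bundles using (CommutativeRing)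
open import Data.Bool using (Bool; true; false; not)
open import Data.Fin using (Fin; zero; suc)
import Data.Integer as ℤ
open import Data.Nat using (ℕ; zero; suc)
import Data.Nat as ℕ
open import Data.Product using (Σ; _,_; proj₁; proj₂)
open import Data.Vec.Functional using ([]; _∷_)
open import Function using (_∘_; case_of_)
open import Function.Definitions using (Congruent)
open import Relation.Binary.PropositionalEquality as ≡ using (_≡_; _≗_)

module Counting where

  open import Data.Bool using (_∧_; if_then_else_)
  open import Data.Bool.Properties using () renaming (_≟_ to _≟ᵇ_)
  open import Data.Fin using (_≟_)
  open import Data.Nat using (_+_; _*_)
  open import Data.Nat.Properties
    using (+-*-semiring; ≤-total; m≤n⇒∃[o]m+o≡n; +-cancelʳ-≡; *-zeroʳ; *-identityʳ; +-identityʳ; *-distribˡ-+)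
  open import Data.Nat.Divisibility using (_∣_; divides; ∣m+n∣m⇒∣n; n∣m*n)
  open import Data.Nat.Coprimality using (Coprime; coprime-divisor; coprime?)
  open import Data.Nat.Tactic.RingSolver using (solve-∀)
  open import Data.Sum using (inj₁; inj₂)
  open import Relation.Nullary.Decidable using (⌊_⌋; ⌊⌋-map′; from-yes)
  open import Relation.Binary.PropositionalEquality
  open import Algebra.Properties.Semiring.Sum +-*-semiring
    using (sum-syntax; sum-cong-≗; ∑-distrib-+; ∑-comm; *-distribˡ-sum; *-distribʳ-sum; sum-replicate-zero)

  infix 3 _≡_mod_

  data _≡_mod_ : ℕ → ℕ → ℕ → Set where
    left  : ∀ {k} n q → n + q * k ≡ n mod k
    right : ∀ {k} m q → m ≡ m + q * k mod k

  module _ {k c : ℕ} (k⊥c : Coprime k c) where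

    divides-gap : ∀ s s' d r → s * k + c * (d + r) ≡ s' * k + c * d → k ∣ r
    divides-gap s s' d r eq = coprime-divisor k⊥c (∣m+n∣m⇒∣n k∣s*k+c*r (n∣m*n s))
      where
      rearrange : ∀ s k c d r → s * k + c * (d + r) ≡ (s * k + c * r) + c * d
      rearrange = solve-∀
      k∣s*k+c*r : k ∣ s * k + c * r
      k∣s*k+c*r = subst (k ∣_) (sym (+-cancelʳ-≡ (c * d) _ _ (trans (sym (rearrange s k c d r)) eq))) (n∣m*n s')

    cancel-coprime : ∀ s s' a d → s * k + c * a ≡ s' * k + c * d → a ≡ d mod k
    cancel-coprime s s' a d eq with ≤-total d a
    ... | inj₁ d≤a with r , refl ← m≤n⇒∃[o]m+o≡n d≤a
                   with divides q refl ← divides-gap s s' d r eq = left d q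
    ... | inj₂ a≤d with r , refl ← m≤n⇒∃[o]m+o≡n a≤d
                   with divides q refl ← divides-gap s' s a r (sym eq) = right a q

  indicator : Bool → ℕ
  indicator b = if b then 1 else 0

  countFin≡∑ : ∀ {k} (p : Fin k → Bool) → countFin p ≡ ∑[ i < k ] indicator (p i)
  countFin≡∑ {zero}  p = refl
  countFin≡∑ {suc k} p = cong (indicator (p zero) +_) (countFin≡∑ (p ∘ suc))

  ∑-δ : ∀ {n} (f : Fin n → ℕ) (i : Fin n) → ∑[ v < n ] (f v * indicator ⌊ i ≟ v ⌋) ≡ f i
  ∑-δ {suc n} f zero = trans (cong₂ _+_ (*-identityʳ (f zero)) ∑-others-vanish) (+-identityʳ (f zero))
    where
    ∑-others-vanish : ∑[ v < n ] (f (suc v) * 0) ≡ 0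
    ∑-others-vanish = trans (sum-cong-≗ (λ v → *-zeroʳ (f (suc v)))) (sum-replicate-zero n)
  ∑-δ {suc n} f (suc i) = cong₂ _+_ (*-zeroʳ (f zero)) (trans (sum-cong-≗ shift) (∑-δ (f ∘ suc) i))
    where
    shift : ∀ v → f (suc v) * indicator ⌊ suc i ≟ suc v ⌋ ≡ f (suc v) * indicator ⌊ i ≟ v ⌋
    shift v = cong (λ b → f (suc v) * indicator b) (⌊⌋-map′ _ _ (i ≟ v))

  preimageCount : ∀ {m n} → (Fin m → Fin n) → Fin n → ℕ
  preimageCount g v = countFin (λ e → ⌊ g e ≟ v ⌋)

  ∑-*-preimageCount : ∀ {m n} (f : Fin n → ℕ) (g : Fin m → Fin n) →
                      ∑[ v < n ] (f v * preimageCount g v) ≡ ∑[ e < m ] f (g e)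
  ∑-*-preimageCount {m} {n} f g = begin
    ∑[ v < n ] (f v * preimageCount g v)                   ≡⟨ sum-cong-≗ (λ v → cong (f v *_) (countFin≡∑ (hits v))) ⟩
    ∑[ v < n ] (f v * ∑[ e < m ] δ v e)                    ≡⟨ sum-cong-≗ (λ v → *-distribˡ-sum (f v) (δ v)) ⟩
    ∑[ v < n ] ∑[ e < m ] (f v * δ v e)                    ≡⟨ ∑-comm (λ v e → f v * δ v e) ⟩
    ∑[ e < m ] ∑[ v < n ] (f v * indicator ⌊ g e ≟ v ⌋)   ≡⟨ sum-cong-≗ (λ e → ∑-δ f (g e)) ⟩
    ∑[ e < m ] f (g e)                                     ∎
    where
    open ≡-Reasoning
    hits : Fin n → Fin m → Bool
    hits v e = ⌊ g e ≟ v ⌋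
    δ : Fin n → Fin m → ℕ
    δ v e = indicator (hits v e)

  pairIs : Bool → Bool → Bool → Bool → Bool
  pairIs a b p q = ⌊ a ≟ᵇ p ⌋ ∧ ⌊ b ≟ᵇ q ⌋

  pairCount : ∀ {m} → (Fin m → Bool) → (Fin m → Bool) → Bool → Bool → ℕ
  pairCount {m} s t p q = ∑[ e < m ] indicator (pairIs (s e) (t e) p q)

  pairCount-not : ∀ {m} (s t : Fin m → Bool) p q →
                  pairCount (not ∘ s) (not ∘ t) p q ≡ pairCount s t (not p) (not q)
  pairCount-not s t p q = sum-cong-≗ λ e → cong indicator (cong₂ _∧_ (⌊not≟⌋ (s e) p) (⌊not≟⌋ (t e) q))
    where
    ⌊not≟⌋ : ∀ a b → ⌊ not a ≟ᵇ b ⌋ ≡ ⌊ a ≟ᵇ not b ⌋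
    ⌊not≟⌋ false false = refl
    ⌊not≟⌋ false true  = refl
    ⌊not≟⌋ true  false = refl
    ⌊not≟⌋ true  true  = refl

  module _ (G : DiGraph) where
    open DiGraph G

    src dst : Fin m → Fin n
    src = proj₁ ∘ edge
    dst = proj₂ ∘ edge

    ∑-degree : (f : Fin n → ℕ) → ∑[ v < n ] (f v * degree G v) ≡ ∑[ e < m ] (f (src e) + f (dst e))
    ∑-degree f = begin
      ∑[ v < n ] (f v * degree G v)
        ≡⟨ sum-cong-≗ (λ v → *-distribˡ-+ (f v) _ _) ⟩
      ∑[ v < n ] (f v * preimageCount src v + f v * preimageCount dst v)
        ≡⟨ ∑-distrib-+ (λ v → f v * preimageCount src v) (λ v → f v * preimageCount dst v) ⟩
      ∑[ v < n ] (f v * preimageCount src v) + ∑[ v < n ] (f v * preimageCount dst v)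
        ≡⟨ cong₂ _+_ (∑-*-preimageCount f src) (∑-*-preimageCount f dst) ⟩
      ∑[ e < m ] f (src e) + ∑[ e < m ] f (dst e)
        ≡⟨ ∑-distrib-+ (f ∘ src) (f ∘ dst) ⟨
      ∑[ e < m ] (f (src e) + f (dst e))
        ∎
      where open ≡-Reasoning

    edgeCount : (Fin n → Bool) → Bool → Bool → ℕ
    edgeCount σ = pairCount (σ ∘ src) (σ ∘ dst)

    ones : (Fin n → Bool) → ℕ
    ones σ = ∑[ v < n ] indicator (σ v)

    endpointWeight : Bool → Bool → ℕ
    endpointWeight a b = indicator a + indicator b + 2 * indicator (pairIs a b false false)

    endpointWeight-not : ∀ a b → endpointWeight (not a) (not b) ≡ endpointWeight a b
    endpointWeight-not false false = refl
    endpointWeight-not false true  = refl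
    endpointWeight-not true  false = refl
    endpointWeight-not true  true  = refl

    ∑-endpointWeight : Is3Regular G → ∀ σ →
      ones σ * 3 + 2 * edgeCount σ false false ≡ ∑[ e < m ] endpointWeight (σ (src e)) (σ (dst e))
    ∑-endpointWeight reg σ = begin
      ones σ * 3 + 2 * edgeCount σ false false
        ≡⟨ cong₂ _+_ (*-distribʳ-sum 3 (indicator ∘ σ)) (*-distribˡ-sum 2 (indicator ∘ bothFalse)) ⟩
      ∑[ v < n ] (indicator (σ v) * 3) + ∑[ e < m ] (2 * indicator (bothFalse e))
        ≡⟨ cong (_+ ∑[ e < m ] (2 * indicator (bothFalse e)))
                (trans (sum-cong-≗ degree≡3) (∑-degree (indicator ∘ σ))) ⟩
      ∑[ e < m ] (indicator (σ (src e)) + indicator (σ (dst e))) + ∑[ e < m ] (2 * indicator (bothFalse e))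
        ≡⟨ ∑-distrib-+ (λ e → indicator (σ (src e)) + indicator (σ (dst e))) (λ e → 2 * indicator (bothFalse e)) ⟨
      ∑[ e < m ] endpointWeight (σ (src e)) (σ (dst e))
        ∎
      where
      open ≡-Reasoning
      bothFalse : Fin m → Bool
      bothFalse e = pairIs (σ (src e)) (σ (dst e)) false false
      degree≡3 : ∀ v → indicator (σ v) * 3 ≡ indicator (σ v) * degree G v
      degree≡3 v = cong (indicator (σ v) *_) (sym (reg v))

    endpoint-balance : Is3Regular G → ∀ σ →
      ones σ * 3 + 2 * edgeCount σ false false ≡ ones (not ∘ σ) * 3 + 2 * edgeCount σ true true
    endpoint-balance reg σ = begin
      ones σ * 3 + 2 * edgeCount σ false false                  ≡⟨ ∑-endpointWeight reg σ ⟩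
      ∑[ e < m ] endpointWeight (σ (src e)) (σ (dst e))
                                                                ≡⟨ sum-cong-≗ (λ e → endpointWeight-not (σ (src e)) (σ (dst e))) ⟨
      ∑[ e < m ] endpointWeight (not (σ (src e))) (not (σ (dst e)))
                                                                ≡⟨ ∑-endpointWeight reg (not ∘ σ) ⟨
      ones (not ∘ σ) * 3 + 2 * edgeCount (not ∘ σ) false false  ≡⟨ cong (λ c → ones (not ∘ σ) * 3 + 2 * c) complement ⟩
      ones (not ∘ σ) * 3 + 2 * edgeCount σ true true            ∎
      where
      open ≡-Reasoning
      complement : edgeCount (not ∘ σ) false false ≡ edgeCount σ true true
      complement = pairCount-not (σ ∘ src) (σ ∘ dst) false false

    edgeCount-congruence : Is3Regular G → ∀ σ → edgeCount σ false false ≡ edgeCount σ true true mod 3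
    edgeCount-congruence reg σ = cancel-coprime 3⊥2 (ones σ) (ones (not ∘ σ)) _ _ (endpoint-balance reg σ)
      where
      3⊥2 : Coprime 3 2
      3⊥2 = from-yes (coprime? 3 2)

open Counting

infixr 8 _^ᴾ_

_^ᴾ_ : ∀ {k} → Poly k → ℕ → Poly k
p ^ᴾ zero  = con (ℤ.+ 1)
p ^ᴾ suc n = p ⊗ (p ^ᴾ n)

lucas : ∀ {k} → Poly k → Poly k → Poly k → Poly k → ℕ → Poly k
lucas s p u₀ u₁ zero          = u₀
lucas s p u₀ u₁ (suc zero)    = u₁
lucas s p u₀ u₁ (suc (suc j)) =
  (s ⊗ lucas s p u₀ u₁ (suc j)) ⊕ (con ℤ.-[1+ 0 ] ⊗ (p ⊗ lucas s p u₀ u₁ j))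

polySum : ∀ {k} (n : ℕ) → ((Fin n → Bool) → Poly k) → Poly k
polySum zero    f = f []
polySum (suc n) f = polySum n (f ∘ (false ∷_)) ⊕ polySum n (f ∘ (true ∷_))

wz xy w³+z³ x+y w³x+yz³ w³y+xz³ : Poly 6
wz        = var zero
xy        = var (suc zero)
w³+z³     = var (suc (suc zero))
x+y       = var (suc (suc (suc zero)))
w³x+yz³   = var (suc (suc (suc (suc zero))))
w³y+xz³   = var (suc (suc (suc (suc (suc zero)))))

lucasWZ lucasXY : Poly 6 → Poly 6 → ℕ → Poly 6
lucasWZ = lucas w³+z³ (wz ⊗ (wz ⊗ wz))
lucasXY = lucas x+y xy

powerSum : ℕ → Poly 6
powerSum = lucasWZ (con (ℤ.+ 2)) w³+z³

reduced : ℕ → ℕ → ℕ → Poly 6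
reduced t zero    c       = lucasXY (powerSum t) (lucasWZ x+y w³y+xz³ t) c
reduced t (suc b) zero    = lucasXY (powerSum t) (lucasWZ x+y w³x+yz³ t) (suc b)
reduced t (suc b) (suc c) = xy ⊗ reduced t b c

pairPoly : ∀ {a d} → a ≡ d mod 3 → ℕ → ℕ → Poly 6
pairPoly (left d t)  b c = (wz ^ᴾ d) ⊗ reduced t b c
pairPoly (right a t) b c = (wz ^ᴾ a) ⊗ reduced t c b

assignmentPoly : (G : DiGraph) → Is3Regular G → (Fin (DiGraph.n G) → Bool) → Poly 6
assignmentPoly G reg σ = pairPoly (edgeCount-congruence G reg σ) (edgeCount G σ false true) (edgeCount G σ true false)

holantPoly : (G : DiGraph) → Is3Regular G → Poly 6
holantPoly record { n = zero }    _   = con (ℤ.+ 1)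
holantPoly G@record { n = suc k } reg = polySum k (λ τ → assignmentPoly G reg (false ∷ τ))

module Evaluation (R : CommutativeRing 0ℓ 0ℓ) where
  open CommutativeRing R hiding (zero)
  open import Algebra.Properties.CommutativeSemiring.Exp commutativeSemiring using (_^_; ^-distrib-*; ^-homo-*)
  open import Algebra.Properties.Ring ring using (-1*x≈-x)
  open import Algebra.Properties.CommutativeSemigroup +-commutativeSemigroup using (interchange)
  open import Algebra.Solver.Ring.NaturalCoefficients.Default commutativeSemiring
    using (solve; _:+_; _:*_; _:=_) renaming (con to :con)
  open import Relation.Binary.Reasoning.Setoid setoid

  x≈y+z⇒x+[-1]z≈y : ∀ {x y z} → x ≈ y + z → x + - (1# + 0#) * z ≈ y
  x≈y+z⇒x+[-1]z≈y {x} {y} {z} x≈y+z = begin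
    x + - (1# + 0#) * z  ≈⟨ +-cong x≈y+z (trans (*-congʳ (-‿cong (+-identityʳ 1#))) (-1*x≈-x z)) ⟩
    (y + z) + - z        ≈⟨ +-assoc y z (- z) ⟩
    y + (z + - z)        ≈⟨ +-congˡ (-‿inverseʳ z) ⟩
    y + 0#               ≈⟨ +-identityʳ y ⟩
    y                    ∎

  eval-^ᴾ : ∀ {k} (ρ : Fin k → Carrier) p n → eval R (p ^ᴾ n) ρ ≈ eval R p ρ ^ n
  eval-^ᴾ ρ p zero    = +-identityʳ 1#
  eval-^ᴾ ρ p (suc n) = *-congˡ (eval-^ᴾ ρ p n)

  eval-lucas : ∀ {k} (ρ : Fin k → Carrier) {s p u₀ u₁ : Poly k} {X Y α β : Carrier} →
    eval R s ρ ≈ X + Y → eval R p ρ ≈ X * Y →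
    eval R u₀ ρ ≈ α + β → eval R u₁ ρ ≈ α * X + β * Y →
    ∀ j → eval R (lucas s p u₀ u₁ j) ρ ≈ α * X ^ j + β * Y ^ j
  eval-lucas ρ {α = α} {β} s≈ p≈ u₀≈ u₁≈ zero =
    trans u₀≈ (sym (+-cong (*-identityʳ α) (*-identityʳ β)))
  eval-lucas ρ {X = X} {Y} s≈ p≈ u₀≈ u₁≈ (suc zero) =
    trans u₁≈ (sym (+-cong (*-congˡ (*-identityʳ X)) (*-congˡ (*-identityʳ Y))))
  eval-lucas ρ {X = X} {Y} {α} {β} s≈ p≈ u₀≈ u₁≈ (suc (suc j)) =
    x≈y+z⇒x+[-1]z≈y (trans (*-cong s≈ (eval-lucas ρ s≈ p≈ u₀≈ u₁≈ (suc j)))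
                           (trans (step X Y α β (X ^ j) (Y ^ j))
                                  (+-congˡ (*-cong (sym p≈) (sym (eval-lucas ρ s≈ p≈ u₀≈ u₁≈ j))))))
    where
    step : ∀ X Y α β Xʲ Yʲ →
      (X + Y) * (α * (X * Xʲ) + β * (Y * Yʲ))
        ≈ (α * (X * (X * Xʲ)) + β * (Y * (Y * Yʲ))) + X * Y * (α * Xʲ + β * Yʲ)
    step = solve 6 (λ X Y α β Xʲ Yʲ →
      (X :+ Y) :* (α :* (X :* Xʲ) :+ β :* (Y :* Yʲ))
        := (α :* (X :* (X :* Xʲ)) :+ β :* (Y :* (Y :* Yʲ))) :+ X :* Y :* (α :* Xʲ :+ β :* Yʲ)) refl

  sumAssign-cong : ∀ k {F H : (Fin k → Bool) → Carrier} → (∀ σ → F σ ≈ H σ) →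
                   sumAssign R k F ≈ sumAssign R k H
  sumAssign-cong zero    F≈H = F≈H _
  sumAssign-cong (suc k) F≈H = +-cong (sumAssign-cong k (F≈H ∘ _)) (sumAssign-cong k (F≈H ∘ _))

  sumAssign-+ : ∀ k (F H : (Fin k → Bool) → Carrier) →
                sumAssign R k (λ σ → F σ + H σ) ≈ sumAssign R k F + sumAssign R k H
  sumAssign-+ zero    F H = refl
  sumAssign-+ (suc k) F H = trans (+-cong (sumAssign-+ k _ _) (sumAssign-+ k _ _)) (interchange _ _ _ _)

  ∷-cong : ∀ {k} b {σ τ : Fin k → Bool} → σ ≗ τ → (b ∷ σ) ≗ (b ∷ τ)
  ∷-cong b σ≗τ zero    = ≡.refl
  ∷-cong b σ≗τ (suc i) = σ≗τ i

  not-∷ : ∀ {k} b (σ : Fin k → Bool) → not ∘ (b ∷ σ) ≗ not b ∷ (not ∘ σ)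
  not-∷ b σ zero    = ≡.refl
  not-∷ b σ (suc i) = ≡.refl

  -- sumAssign extends assignments by its own local copy of _∷_, which agrees with it only pointwise.
  sumAssign-suc : ∀ k {F : (Fin (suc k) → Bool) → Carrier} → Congruent _≗_ _≈_ F →
                  sumAssign R (suc k) F ≈ sumAssign R k (F ∘ (false ∷_)) + sumAssign R k (F ∘ (true ∷_))
  sumAssign-suc k F-cong = +-cong (sumAssign-cong k λ σ → F-cong λ { zero → ≡.refl ; (suc i) → ≡.refl })
                                  (sumAssign-cong k λ σ → F-cong λ { zero → ≡.refl ; (suc i) → ≡.refl })

  sumAssign-complement : ∀ k {F : (Fin k → Bool) → Carrier} → Congruent _≗_ _≈_ F →
                  sumAssign R k F ≈ sumAssign R k (F ∘ (not ∘_))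
  sumAssign-complement zero    F-cong = F-cong λ ()
  sumAssign-complement (suc k) {F} F-cong = begin
    sumAssign R (suc k) F
      ≈⟨ sumAssign-suc k F-cong ⟩
    sumAssign R k (F ∘ (false ∷_)) + sumAssign R k (F ∘ (true ∷_))
      ≈⟨ +-comm _ _ ⟩
    sumAssign R k (F ∘ (true ∷_)) + sumAssign R k (F ∘ (false ∷_))
      ≈⟨ +-cong (sumAssign-complement k (F-cong ∘ ∷-cong true)) (sumAssign-complement k (F-cong ∘ ∷-cong false)) ⟩
    sumAssign R k (λ σ → F (true ∷ (not ∘ σ))) + sumAssign R k (λ σ → F (false ∷ (not ∘ σ)))
      ≈⟨ +-cong (sumAssign-cong k λ σ → F-cong (not-∷ false σ)) (sumAssign-cong k λ σ → F-cong (not-∷ true σ)) ⟨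
    sumAssign R k (λ σ → F (not ∘ (false ∷ σ))) + sumAssign R k (λ σ → F (not ∘ (true ∷ σ)))
      ≈⟨ sumAssign-suc k (F-cong ∘ (λ σ≗τ → ≡.cong not ∘ σ≗τ)) ⟨
    sumAssign R (suc k) (F ∘ (not ∘_))
      ∎

  sumAssign-complementPairs : ∀ k {F : (Fin (suc k) → Bool) → Carrier} → Congruent _≗_ _≈_ F →
    sumAssign R (suc k) F ≈ sumAssign R k (λ τ → F (false ∷ τ) + F (not ∘ (false ∷ τ)))
  sumAssign-complementPairs k {F} F-cong = begin
    sumAssign R (suc k) F
      ≈⟨ sumAssign-suc k F-cong ⟩
    sumAssign R k (F ∘ (false ∷_)) + sumAssign R k (F ∘ (true ∷_))
      ≈⟨ +-congˡ (sumAssign-complement k (F-cong ∘ ∷-cong true)) ⟩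
    sumAssign R k (F ∘ (false ∷_)) + sumAssign R k (λ τ → F (true ∷ (not ∘ τ)))
      ≈⟨ +-congˡ (sumAssign-cong k λ τ → F-cong (not-∷ false τ)) ⟨
    sumAssign R k (F ∘ (false ∷_)) + sumAssign R k (λ τ → F (not ∘ (false ∷ τ)))
      ≈⟨ sumAssign-+ k _ _ ⟨
    sumAssign R k (λ τ → F (false ∷ τ) + F (not ∘ (false ∷ τ)))
      ∎

  eval-polySum : ∀ {j} (ρ : Fin j → Carrier) k (f : (Fin k → Bool) → Poly j) {H : (Fin k → Bool) → Carrier} →
    Congruent _≗_ _≈_ H → (∀ σ → eval R (f σ) ρ ≈ H σ) → eval R (polySum k f) ρ ≈ sumAssign R k H
  eval-polySum ρ zero    f H-cong f≈H = trans (f≈H []) (H-cong λ ())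
  eval-polySum ρ (suc k) f H-cong f≈H =
    trans (+-cong (eval-polySum ρ k _ (H-cong ∘ ∷-cong false) (f≈H ∘ (false ∷_)))
                  (eval-polySum ρ k _ (H-cong ∘ ∷-cong true) (f≈H ∘ (true ∷_))))
          (sym (sumAssign-suc k H-cong))

  module _ (w x y z : Carrier) where

    ev : Poly 6 → Carrier
    ev p = eval R p (args6 R w x y z)

    W Z : Carrier
    W = cube R w
    Z = cube R z

    eval-lucasWZ : ∀ {u₀ u₁ α β} → ev u₀ ≈ α + β → ev u₁ ≈ α * W + β * Z →
                ∀ t → ev (lucasWZ u₀ u₁ t) ≈ α * W ^ t + β * Z ^ t
    eval-lucasWZ = eval-lucas _ refl (w³z³ w z)
      where
      w³z³ : ∀ w z → (w * z) * ((w * z) * (w * z)) ≈ cube R w * cube R z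
      w³z³ = solve 2 (λ w z → (w :* z) :* ((w :* z) :* (w :* z)) := (w :* w :* w) :* (z :* z :* z)) refl

    eval-lucasXY : ∀ {u₀ u₁ α β} → ev u₀ ≈ α + β → ev u₁ ≈ α * x + β * y →
                ∀ j → ev (lucasXY u₀ u₁ j) ≈ α * x ^ j + β * y ^ j
    eval-lucasXY = eval-lucas _ refl refl

    eval-powerSum : ∀ t → ev (powerSum t) ≈ W ^ t + Z ^ t
    eval-powerSum t = trans (eval-lucasWZ two (sym (+-cong (*-identityˡ W) (*-identityˡ Z))) t)
                            (+-cong (*-identityˡ _) (*-identityˡ _))
      where
      two : 1# + (1# + 0#) ≈ 1# + 1#
      two = +-congˡ (+-identityʳ 1#)

    eval-reduced : ∀ t b c → ev (reduced t b c) ≈ W ^ t * x ^ b * y ^ c + Z ^ t * x ^ c * y ^ b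
    eval-reduced t zero c = trans (eval-lucasXY (trans (eval-powerSum t) (+-comm _ _)) first c) (reorder _ _ _ _)
      where
      first : ev (lucasWZ x+y w³y+xz³ t) ≈ Z ^ t * x + W ^ t * y
      first = trans (eval-lucasWZ (+-comm x y) (+-congʳ (*-comm W y)) t) (trans (+-comm _ _) (+-cong (*-comm x _) (*-comm y _)))
      reorder : ∀ A B X Y → B * X + A * Y ≈ A * 1# * Y + B * X * 1#
      reorder = solve 4 (λ A B X Y → B :* X :+ A :* Y := A :* :con 1 :* Y :+ B :* X :* :con 1) refl
    eval-reduced t (suc b) zero = trans (eval-lucasXY (eval-powerSum t) first (suc b)) (reorder _ _ _ _)
      where
      first : ev (lucasWZ x+y w³x+yz³ t) ≈ W ^ t * x + Z ^ t * y
      first = trans (eval-lucasWZ refl (+-congʳ (*-comm W x)) t) (+-cong (*-comm x _) (*-comm y _))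
      reorder : ∀ A B X Y → A * X + B * Y ≈ A * X * 1# + B * 1# * Y
      reorder = solve 4 (λ A B X Y → A :* X :+ B :* Y := A :* X :* :con 1 :+ B :* :con 1 :* Y) refl
    eval-reduced t (suc b) (suc c) = trans (*-congˡ (eval-reduced t b c)) (distribute _ _ _ _ _ _ _ _)
      where
      distribute : ∀ x y A B xᵇ yᶜ xᶜ yᵇ →
        x * y * (A * xᵇ * yᶜ + B * xᶜ * yᵇ) ≈ A * (x * xᵇ) * (y * yᶜ) + B * (x * xᶜ) * (y * yᵇ)
      distribute = solve 8 (λ x y A B xᵇ yᶜ xᶜ yᵇ →
        x :* y :* (A :* xᵇ :* yᶜ :+ B :* xᶜ :* yᵇ)
          := A :* (x :* xᵇ) :* (y :* yᶜ) :+ B :* (x :* xᶜ) :* (y :* yᵇ)) refl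

    monomial : ℕ → ℕ → ℕ → ℕ → Carrier
    monomial a b c d = w ^ a * x ^ b * y ^ c * z ^ d

    pairedMonomials : ℕ → ℕ → ℕ → ℕ → Carrier
    pairedMonomials a b c d = monomial a b c d + monomial d c b a

    ^-cube : ∀ u t → u ^ (t ℕ.* 3) ≈ cube R u ^ t
    ^-cube u zero    = refl
    ^-cube u (suc t) = trans (*-congˡ (*-congˡ (*-congˡ (^-cube u t)))) (reassociate u _)
      where
      reassociate : ∀ u P → u * (u * (u * P)) ≈ u * u * u * P
      reassociate = solve 2 (λ u P → u :* (u :* (u :* P)) := u :* u :* u :* P) refl

    eval-wzᵈ⊗reduced : ∀ d t b c →
      ev ((wz ^ᴾ d) ⊗ reduced t b c) ≈ pairedMonomials (d ℕ.+ t ℕ.* 3) b c d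
    eval-wzᵈ⊗reduced d t b c = begin
      ev (wz ^ᴾ d) * ev (reduced t b c)
        ≈⟨ *-cong (trans (eval-^ᴾ _ wz d) (^-distrib-* w z d)) (eval-reduced t b c) ⟩
      w ^ d * z ^ d * (W ^ t * x ^ b * y ^ c + Z ^ t * x ^ c * y ^ b)
        ≈⟨ distribute _ _ _ _ _ _ _ _ ⟩
      w ^ d * W ^ t * x ^ b * y ^ c * z ^ d + w ^ d * x ^ c * y ^ b * (z ^ d * Z ^ t)
        ≈⟨ +-cong (*-congʳ (*-congʳ (*-congʳ (shift w)))) (*-congˡ (shift z)) ⟨
      pairedMonomials (d ℕ.+ t ℕ.* 3) b c d
        ∎
      where
      shift : ∀ u → u ^ (d ℕ.+ t ℕ.* 3) ≈ u ^ d * cube R u ^ t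
      shift u = trans (^-homo-* u d (t ℕ.* 3)) (*-congˡ (^-cube u t))
      distribute : ∀ wᵈ zᵈ A B xᵇ yᶜ xᶜ yᵇ →
        wᵈ * zᵈ * (A * xᵇ * yᶜ + B * xᶜ * yᵇ) ≈ wᵈ * A * xᵇ * yᶜ * zᵈ + wᵈ * xᶜ * yᵇ * (zᵈ * B)
      distribute = solve 8 (λ wᵈ zᵈ A B xᵇ yᶜ xᶜ yᵇ →
        wᵈ :* zᵈ :* (A :* xᵇ :* yᶜ :+ B :* xᶜ :* yᵇ)
          := wᵈ :* A :* xᵇ :* yᶜ :* zᵈ :+ wᵈ :* xᶜ :* yᵇ :* (zᵈ :* B)) refl

    eval-pairPoly : ∀ {a d} (a≡d : a ≡ d mod 3) b c → ev (pairPoly a≡d b c) ≈ pairedMonomials a b c d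
    eval-pairPoly (left d t)  b c = eval-wzᵈ⊗reduced d t b c
    eval-pairPoly (right a t) b c = trans (eval-wzᵈ⊗reduced a t c b) (+-comm _ _)

    prodFin-sig : ∀ {m} (s t : Fin m → Bool) →
      prodFin R (λ e → sig R w x y z (s e) (t e))
        ≈ monomial (pairCount s t false false) (pairCount s t false true) (pairCount s t true false) (pairCount s t true true)
    prodFin-sig {zero}  s t = sym (trans (*-identityʳ _) (trans (*-identityʳ _) (*-identityʳ 1#)))
    prodFin-sig {suc m} s t with s zero | t zero
    ... | false | false = trans (*-congˡ (prodFin-sig (s ∘ suc) (t ∘ suc))) (absorb₁ _ _ _ _ _)
      where
      absorb₁ : ∀ u A B C D → u * (A * B * C * D) ≈ u * A * B * C * D
      absorb₁ = solve 5 (λ u A B C D → u :* (A :* B :* C :* D) := u :* A :* B :* C :* D) refl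
    ... | false | true  = trans (*-congˡ (prodFin-sig (s ∘ suc) (t ∘ suc))) (absorb₂ _ _ _ _ _)
      where
      absorb₂ : ∀ u A B C D → u * (A * B * C * D) ≈ A * (u * B) * C * D
      absorb₂ = solve 5 (λ u A B C D → u :* (A :* B :* C :* D) := A :* (u :* B) :* C :* D) refl
    ... | true  | false = trans (*-congˡ (prodFin-sig (s ∘ suc) (t ∘ suc))) (absorb₃ _ _ _ _ _)
      where
      absorb₃ : ∀ u A B C D → u * (A * B * C * D) ≈ A * B * (u * C) * D
      absorb₃ = solve 5 (λ u A B C D → u :* (A :* B :* C :* D) := A :* B :* (u :* C) :* D) refl
    ... | true  | true  = trans (*-congˡ (prodFin-sig (s ∘ suc) (t ∘ suc))) (absorb₄ _ _ _ _ _)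
      where
      absorb₄ : ∀ u A B C D → u * (A * B * C * D) ≈ A * B * C * (u * D)
      absorb₄ = solve 5 (λ u A B C D → u :* (A :* B :* C :* D) := A :* B :* C :* (u :* D)) refl

    weight : (G : DiGraph) → (Fin (DiGraph.n G) → Bool) → Carrier
    weight G σ = prodFin R (λ e → sig R w x y z (σ (src G e)) (σ (dst G e)))

    weight-cong : ∀ G → Congruent _≗_ _≈_ (weight G)
    weight-cong G σ≗τ = prodFin-cong (λ e → reflexive (≡.cong₂ (sig R w x y z) (σ≗τ (src G e)) (σ≗τ (dst G e))))
      where
      prodFin-cong : ∀ {m} {f g : Fin m → Carrier} → (∀ e → f e ≈ g e) → prodFin R f ≈ prodFin R g
      prodFin-cong {zero}  f≈g = refl
      prodFin-cong {suc m} f≈g = *-cong (f≈g zero) (prodFin-cong (f≈g ∘ suc))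

    weight-complementPair : ∀ G σ → weight G σ + weight G (not ∘ σ)
      ≈ pairedMonomials (edgeCount G σ false false) (edgeCount G σ false true)
                        (edgeCount G σ true false) (edgeCount G σ true true)
    weight-complementPair G σ =
      +-cong (prodFin-sig (σ ∘ src G) (σ ∘ dst G))
             (trans (prodFin-sig (not ∘ σ ∘ src G) (not ∘ σ ∘ dst G))
                    (reflexive (monomial-not (σ ∘ src G) (σ ∘ dst G))))
      where
      monomial-not : ∀ {m} (s t : Fin m → Bool) →
        monomial (pairCount (not ∘ s) (not ∘ t) false false) (pairCount (not ∘ s) (not ∘ t) false true)
                 (pairCount (not ∘ s) (not ∘ t) true false) (pairCount (not ∘ s) (not ∘ t) true true)
          ≡ monomial (pairCount s t true true) (pairCount s t true false) (pairCount s t false true) (pairCount s t false false)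
      monomial-not s t rewrite pairCount-not s t false false | pairCount-not s t false true
                             | pairCount-not s t true false  | pairCount-not s t true true = ≡.refl

    eval-assignmentPoly : ∀ G reg σ → ev (assignmentPoly G reg σ) ≈ weight G σ + weight G (not ∘ σ)
    eval-assignmentPoly G reg σ = trans (eval-pairPoly (edgeCount-congruence G reg σ) _ _) (sym (weight-complementPair G σ))

    holant≈eval : ∀ G reg → holant R G w x y z ≈ ev (holantPoly G reg)
    holant≈eval record { n = zero ; m = zero }              _ = sym (+-identityʳ 1#)
    holant≈eval record { n = zero ; m = suc _ ; edge = edge } _ = case proj₁ (edge zero) of λ ()
    holant≈eval G@record { n = suc k } reg = begin
      sumAssign R (suc k) (weight G)
        ≈⟨ sumAssign-complementPairs k (weight-cong G) ⟩
      sumAssign R k (λ τ → weight G (false ∷ τ) + weight G (not ∘ (false ∷ τ)))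
        ≈⟨ eval-polySum _ k _ pair-cong (eval-assignmentPoly G reg ∘ (false ∷_)) ⟨
      ev (holantPoly G reg)
        ∎
      where
      pair-cong : Congruent _≗_ _≈_ (λ τ → weight G (false ∷ τ) + weight G (not ∘ (false ∷ τ)))
      pair-cong σ≗τ = +-cong (weight-cong G (∷-cong false σ≗τ)) (weight-cong G (≡.cong not ∘ ∷-cong false σ≗τ))

lemmaD4 : (G : DiGraph) → Is3Regular G →
    Σ (Poly 6) (λ P → (R : CommutativeRing 0ℓ 0ℓ) →
      (w x y z : CommutativeRing.Carrier R) →
      CommutativeRing._≈_ R (holant R G w x y z) (eval R P (args6 R w x y z)))
lemmaD4 G reg = holantPoly G reg , λ R w x y z → Evaluation.holant≈eval R w x y z G reg
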